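{- Let $\mathcal{F}$ be an unsatisfiable CNF formula, let $a_i$ be a complete assignment to the variables of $\mathcal{F}$, and let $a_j \in A(c_j,\mathcal{F})$ be an assoc for some clause $c_j \in \mathcal{F}$. Then either $a_i$ is an assoc for $c_j$, or there exists a literal $l \in \bigcup \mathrm{Unsat}(\mathcal{F},a_i)$ such that $l \in a_j \setminus a_i$.
   Context: A literal is a Boolean variable $x$ or its negation $\lnot x$, with $\lnot\lnot l = l$. A clause is a non-empty set of literals (a disjunction); a CNF formula $\mathcal{F}$ is a set of clauses (a conjunction). An assignment is a set of literals $a$ such that $l \in a$ implies $\lnot l \notin a$. The assignment $a$ satisfies a clause $c$ if $a \cap c \neq \emptyset$, and satisfies a formula if it satisfies all of its clauses. An assignment $a$ is complete for $\mathcal{F}$ if for every $c \in \mathcal{F}$ and every $l \in c$, either $l \in a$ or $\lnot l \in a$; a complete assignment to the variables of $\mathcal{F}$ contains, for each variable $x$ occurring in $\mathcal{F}$, exactly one of $x, \lnot x$. An associated assignment (assoc) for a clause $c \in \mathcal{F}$ is a complete assignment for $\mathcal{F}$ that satisfies $\mathcal{F} \setminus \{c\}$ and does not satisfy $c$. The set of all assocs for $c$ is denoted $A(c,\mathcal{F})$. For an assignment $a$, $\mathrm{Unsat}(\mathcal{F},a) = \{ c \in \mathcal{F} \mid c \cap a = \emptyset\}$ is the set of clauses of $\mathcal{F}$ not satisfied by $a$, and $\bigcup \mathrm{Unsat}(\mathcal{F},a)$ is the set of all literals occurring in these clauses. -}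

module Defs where

open import Data.Nat using (ℕ)
open import Data.List using (List; []; _∷_)
open import Data.List.Membership.Propositional using (_∈_; _∉_)
open import Data.List.Relation.Unary.Any using (Any)
open import Data.List.Relation.Unary.All using (All)
open import Data.Product using (_×_; ∃-syntax)
open import Data.Sum using (_⊎_)
open import Relation.Nullary using (¬_)
open import Data.Empty using (⊥)
open import Data.Unit using (⊤)
open import Relation.Binary.PropositionalEquality using (_≡_)

data Literal : Set where
  pos : ℕ → Literal
  neg : ℕ → Literal

lneg : Literal → Literal
lneg (pos x) = neg x
lneg (neg x) = pos x

Clause : Set
Clause = List Literal

NonEmpty : Clause → Set
NonEmpty []      = ⊥
NonEmpty (_ ∷ _) = ⊤

Formula : Set
Formula = List Clause

WellFormed : Formula → Set
WellFormed F = All NonEmpty F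

Assignment : Set
Assignment = List Literal

Consistent : Assignment → Set
Consistent a = ∀ l → l ∈ a → lneg l ∉ a

SatClause : Assignment → Clause → Set
SatClause a c = ∃[ l ] (l ∈ c × l ∈ a)

SatFormula : Assignment → Formula → Set
SatFormula a F = ∀ c → c ∈ F → SatClause a c

CompleteFor : Formula → Assignment → Set
CompleteFor F a = ∀ c → c ∈ F → ∀ l → l ∈ c → (l ∈ a ⊎ lneg l ∈ a)

-- Complete assignment to the variables of F: a consistent assignment that is
-- complete for F (hence contains exactly one of x, ¬x for each variable x of F).
CompleteAssignment : Formula → Assignment → Set
CompleteAssignment F a = Consistent a × CompleteFor F a

Unsatisfiable : Formula → Set
Unsatisfiable F = ∀ a → Consistent a → ¬ SatFormula a F

-- a is an assoc for c in F (a ∈ A(c,F)):  complete for F, satisfies F \ {c},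
-- and does not satisfy c.  Clauses of F \ {c} are those clauses of F distinct from c.
IsAssoc : Formula → Clause → Assignment → Set
IsAssoc F c a =
  CompleteAssignment F a ×
  (∀ d → d ∈ F → ¬ (d ≡ c) → SatClause a d) ×
  ¬ SatClause a c

InUnsatLits : Formula → Assignment → Literal → Set
InUnsatLits F a l = ∃[ c ] (c ∈ F × ¬ SatClause a c × l ∈ c)

module Submission where

-- Call a clause d of F a *witness clause* for (aᵢ, aⱼ)
-- if aᵢ does not satisfy d and d contains a literal l with l ∈ aⱼ and l ∉ aᵢ;
-- the second alternative of the theorem says exactly that a witness clause
-- exists.  Satisfaction of a clause by a finite assignment is decidable, and
-- so is being a witness clause, so we may decide whether F has one.
--   * If it does, its literal l is the required element of ⋃ Unsat(F,aᵢ).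
--   * If it does not, aᵢ satisfies every clause d ≠ cⱼ: aⱼ satisfies d by
--     some literal l, and l ∉ aᵢ would make d a witness clause unless aᵢ
--     already satisfies d.  Since F is unsatisfiable and aᵢ is consistent,
--     a consistent assignment satisfying all clauses but cⱼ cannot satisfy
--     cⱼ, so aᵢ is an assoc for cⱼ.

open import Defs
open import Data.Nat using () renaming (_≟_ to _≟ℕ_)
open import Data.List.Properties using (≡-dec)
open import Data.List.Membership.Propositional using (_∈_; _∉_; find; lose)
open import Data.List.Relation.Unary.Any using (Any; any?)
open import Data.Product using (_×_; ∃-syntax; _,_; proj₁)
open import Data.Sum using (_⊎_; inj₁; inj₂)
open import Data.Empty using (⊥-elim)
open import Relation.Nullary using (¬_; Dec; yes; no)
open import Relation.Nullary.Decidable using (_×-dec_; ¬?; map′)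
open import Relation.Binary.PropositionalEquality using (_≡_; refl; cong)
open import Relation.Binary.Definitions using (DecidableEquality)

_≟ₗ_ : DecidableEquality Literal
pos x ≟ₗ pos y = map′ (cong pos) (λ { refl → refl }) (x ≟ℕ y)
neg x ≟ₗ neg y = map′ (cong neg) (λ { refl → refl }) (x ≟ℕ y)
pos x ≟ₗ neg y = no λ ()
neg x ≟ₗ pos y = no λ ()

_≟꜀_ : DecidableEquality Clause
_≟꜀_ = ≡-dec _≟ₗ_

open import Data.List.Membership.DecPropositional _≟ₗ_ using (_∈?_)

satClause? : (a : Assignment) (c : Clause) → Dec (SatClause a c)
satClause? a c =
  map′ find (λ (l , l∈c , l∈a) → lose l∈c l∈a) (any? (_∈? a) c)

WitnessClause : Assignment → Assignment → Clause → Set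
WitnessClause aᵢ aⱼ d = ¬ SatClause aᵢ d × Any (λ l → l ∈ aⱼ × l ∉ aᵢ) d

witnessClause? : (aᵢ aⱼ : Assignment) (d : Clause) → Dec (WitnessClause aᵢ aⱼ d)
witnessClause? aᵢ aⱼ d =
  ¬? (satClause? aᵢ d) ×-dec any? (λ l → (l ∈? aⱼ) ×-dec ¬? (l ∈? aᵢ)) d

satisfied-or-witness : (aᵢ aⱼ : Assignment) (d : Clause) →
  SatClause aⱼ d → SatClause aᵢ d ⊎ WitnessClause aᵢ aⱼ d
satisfied-or-witness aᵢ aⱼ d (l , l∈d , l∈aⱼ) with satClause? aᵢ d | l ∈? aᵢ
... | yes sat | _        = inj₁ sat
... | no unsat | yes l∈aᵢ = ⊥-elim (unsat (l , l∈d , l∈aᵢ))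
... | no unsat | no l∉aᵢ  = inj₂ (unsat , lose l∈d (l∈aⱼ , l∉aᵢ))

falsifies-the-exception : (F : Formula) → Unsatisfiable F →
  (a : Assignment) → Consistent a → (c : Clause) →
  (∀ d → d ∈ F → ¬ (d ≡ c) → SatClause a d) → ¬ SatClause a c
falsifies-the-exception F unsat a consistent c satOthers satC =
  unsat a consistent satAll
  where
  satAll : SatFormula a F
  satAll d d∈F with d ≟꜀ c
  ... | yes refl = satC
  ... | no d≢c   = satOthers d d∈F d≢c

witness-literal : (F : Formula) (aᵢ aⱼ : Assignment) →
  Any (WitnessClause aᵢ aⱼ) F →
  ∃[ l ] (InUnsatLits F aᵢ l × l ∈ aⱼ × l ∉ aᵢ)
witness-literal F aᵢ aⱼ witnesses with find witnesses
... | d , d∈F , (unsatD , lits) with find lits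
...   | l , l∈d , (l∈aⱼ , l∉aᵢ) = l , (d , d∈F , unsatD , l∈d) , l∈aⱼ , l∉aᵢ

lemma2 : (F : Formula) → WellFormed F → Unsatisfiable F →
    (aᵢ : Assignment) → CompleteAssignment F aᵢ →
    (cⱼ : Clause) → cⱼ ∈ F →
    (aⱼ : Assignment) → IsAssoc F cⱼ aⱼ →
    IsAssoc F cⱼ aᵢ ⊎ (∃[ l ] (InUnsatLits F aᵢ l × l ∈ aⱼ × l ∉ aᵢ))
lemma2 F _ unsat aᵢ completeᵢ cⱼ _ aⱼ (_ , satOthersⱼ , _)
  with any? (witnessClause? aᵢ aⱼ) F
... | yes witnesses = inj₂ (witness-literal F aᵢ aⱼ witnesses)
... | no noWitness  =
  inj₁ (completeᵢ , satOthersᵢ ,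
        falsifies-the-exception F unsat aᵢ (proj₁ completeᵢ) cⱼ satOthersᵢ)
  where
  satOthersᵢ : ∀ d → d ∈ F → ¬ (d ≡ cⱼ) → SatClause aᵢ d
  satOthersᵢ d d∈F d≢cⱼ with satisfied-or-witness aᵢ aⱼ d (satOthersⱼ d d∈F d≢cⱼ)
  ... | inj₁ sat     = sat
  ... | inj₂ witness = ⊥-elim (noWitness (lose d∈F witness))
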